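{- For every Inclusion Logic formula $\phi(\bar x)$ with free variables among $\bar x=(x_1,\ldots,x_n)$ there is a $\mathrm{PGFP}$-formula $\phi^*(R,\bar x)$, where $R$ is an $n$-ary relation symbol occurring only positively in $\phi^*$, such that for all models $M$ and all teams $X$ on $M$ with $\mathrm{dom}(X)=\{x_1,\ldots,x_n\}$: $$M\models_X\phi(\bar x)\iff (M,X(\bar x))\models_s\phi^*(R,\bar x)\text{ for all } s\in X.$$
   Context: A team $X$ over $M$ with domain $V$ is a set of assignments $s:V\to\mathrm{dom}(M)$; $\bar t\langle s\rangle$ is the value of the tuple of terms $\bar t$ under $s$, and $X(\bar t)=\{\bar t\langle s\rangle:s\in X\}$. $(M,P)$ is the expansion of $M$ interpreting $R$ by $P$. Inclusion Logic formulas are first-order formulas in negation normal form, built from first-order literals and inclusion atoms $\bar t_1\subseteq\bar t_2$ (with $|\bar t_1|=|\bar t_2|$) using $\wedge,\vee,\exists,\forall$, with (lax) team semantics: for a literal $\alpha$, $M\models_X\alpha$ iff $M\models_s\alpha$ (Tarskian) for all $s\in X$; $M\models_X\bar t_1\subseteq\bar t_2$ iff $X(\bar t_1)\subseteq X(\bar t_2)$; $M\models_X\phi\vee\psi$ iff $X=Y\cup Z$ with $M\models_Y\phi$ and $M\models_Z\psi$; $M\models_X\phi\wedge\psi$ iff both hold; $M\models_X\exists v\phi$ iff there is $H:X\to\mathcal P(\mathrm{dom}(M))\setminus\{\emptyset\}$ with $M\models_{X[H/v]}\phi$, where $X[H/v]=\{s[m/v]:s\in X,m\in H(s)\}$; $M\models_X\forall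 v\phi$ iff $M\models_{X[M/v]}\phi$, where $X[M/v]=\{s[m/v]:s\in X,m\in\mathrm{dom}(M)\}$. $\mathrm{PGFP}$ (Positive Greatest Fixed Point Logic) is first-order logic extended by the operator $[\mathrm{gfp}_{S,\bar y}\,\psi(S,\bar y)]\bar t$ ($S$ only positive in $\psi$, $\mathrm{ar}(S)=|\bar y|=|\bar t|$), true under $s$ iff $\bar t\langle s\rangle$ lies in the greatest fixed point of the operator $P\mapsto\{\bar a:(M,P)\models_{s[\bar a/\bar y]}\psi\}$, where gfp-operators occur only positively. -}

module Defs where

open import Level using (Level; Lift; lift) renaming (suc to lsuc; zero to lzero)
open import Data.Nat using (ℕ; zero; suc; _+_)
open import Data.Fin using (Fin)
open import Data.Vec using (Vec; []; _∷_; _++_; lookup; tabulate)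
open import Data.List using (List; []; _∷_)
open import Data.Product using (Σ; _×_; _,_)
open import Data.Sum using (_⊎_)
open import Data.Unit using (⊤; tt)
open import Relation.Nullary using (¬_)
open import Relation.Binary.PropositionalEquality using (_≡_)

record Signature : Set₁ where
  field
    Fun      : Set
    funArity : Fun → ℕ
    Rel      : Set
    relArity : Rel → ℕ
open Signature public

module _ (Sig : Signature) where

  data Term (n : ℕ) : Set where
    var : Fin n → Term n
    app : (f : Fun Sig) → Vec (Term n) (funArity Sig f) → Term n

  data Literal (n : ℕ) : Set where
    eq   : Term n → Term n → Literal n
    neq  : Term n → Term n → Literal n
    rel  : (r : Rel Sig) → Vec (Term n) (relArity Sig r) → Literal n
    nrel : (r : Rel Sig) → Vec (Term n) (relArity Sig r) → Literal n

  -- Inclusion Logic formulas with free variables among x₀ … x_{n-1};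
  -- the quantified variable of ∃/∀ is the new variable 0 of the body.
  data IncFormula (n : ℕ) : Set where
    lit  : Literal n → IncFormula n
    inc  : (k : ℕ) → Vec (Term n) k → Vec (Term n) k → IncFormula n
    _∧ᵢ_ : IncFormula n → IncFormula n → IncFormula n
    _∨ᵢ_ : IncFormula n → IncFormula n → IncFormula n
    ∃ᵢ   : IncFormula (suc n) → IncFormula n
    ∀ᵢ   : IncFormula (suc n) → IncFormula n

  data RVar : List ℕ → ℕ → Set where
    here  : ∀ {k Γ} → RVar (k ∷ Γ) k
    there : ∀ {k j Γ} → RVar Γ k → RVar (j ∷ Γ) k

  -- PGFP formulas (negation normal form): relation variables (including
  -- the gfp-bound ones and R) occur only positively, and gfp-operators
  -- occur only positively.  Γ = arities of the free relation variables,
  -- n = number of free first-order variables.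
  data PGFP (Γ : List ℕ) (n : ℕ) : Set where
    lit  : Literal n → PGFP Γ n
    rvar : ∀ {k} → RVar Γ k → Vec (Term n) k → PGFP Γ n
    _∧ₚ_ : PGFP Γ n → PGFP Γ n → PGFP Γ n
    _∨ₚ_ : PGFP Γ n → PGFP Γ n → PGFP Γ n
    ∃ₚ   : PGFP Γ (suc n) → PGFP Γ n
    ∀ₚ   : PGFP Γ (suc n) → PGFP Γ n
    -- [gfp_{S,ȳ} ψ(S,ȳ)] t̄ : in the body ψ, S is relation variable `here`
    -- and ȳ = the first k first-order variables (followed by the outer ones)
    gfp  : (k : ℕ) → PGFP (k ∷ Γ) (k + n) → Vec (Term n) k → PGFP Γ n

record Structure (Sig : Signature) : Set₁ where
  field
    Carrier : Set
    funs    : (f : Fun Sig) → Vec Carrier (funArity Sig f) → Carrier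
    rels    : (r : Rel Sig) → Vec Carrier (relArity Sig r) → Set
open Structure public

module Semantics {Sig : Signature} (M : Structure Sig) where

  D : Set
  D = Carrier M

  Assignment : ℕ → Set
  Assignment n = Vec D n

  mutual
    ⟦_⟧t : ∀ {n} → Term Sig n → Assignment n → D
    ⟦ var i ⟧t s = lookup s i
    ⟦ app f ts ⟧t s = funs M f (⟦ ts ⟧ts s)

    ⟦_⟧ts : ∀ {n k} → Vec (Term Sig n) k → Assignment n → Vec D k
    ⟦ [] ⟧ts s = []
    ⟦ t ∷ ts ⟧ts s = ⟦ t ⟧t s ∷ ⟦ ts ⟧ts s

  ⟦_⟧l : ∀ {n} → Literal Sig n → Assignment n → Set
  ⟦ eq t u ⟧l s = ⟦ t ⟧t s ≡ ⟦ u ⟧t s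
  ⟦ neq t u ⟧l s = ¬ (⟦ t ⟧t s ≡ ⟦ u ⟧t s)
  ⟦ rel r ts ⟧l s = rels M r (⟦ ts ⟧ts s)
  ⟦ nrel r ts ⟧l s = ¬ rels M r (⟦ ts ⟧ts s)

  Team : ℕ → Set₁
  Team n = Assignment n → Set

  valuesOf : ∀ {n k} → Team n → Vec (Term Sig n) k → Vec D k → Set
  valuesOf {n} X ts a = Σ (Assignment n) λ s → X s × ⟦ ts ⟧ts s ≡ a

  IsUnion : ∀ {n} → Team n → Team n → Team n → Set
  IsUnion X Y Z = (∀ s → X s → Y s ⊎ Z s) × (∀ s → Y s → X s) × (∀ s → Z s → X s)

  supplement : ∀ {n} → Team n → (Assignment n → D → Set) → Team (suc n)
  supplement X H (m ∷ s) = X s × H s m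

  duplicate : ∀ {n} → Team n → Team (suc n)
  duplicate X (m ∷ s) = X s

  _⊨ₜ_ : ∀ {n} → Team n → IncFormula Sig n → Set₁
  X ⊨ₜ lit α = Lift _ (∀ s → X s → ⟦ α ⟧l s)
  X ⊨ₜ inc k t₁ t₂ = Lift _ (∀ a → valuesOf X t₁ a → valuesOf X t₂ a)
  X ⊨ₜ (φ ∧ᵢ ψ) = (X ⊨ₜ φ) × (X ⊨ₜ ψ)
  X ⊨ₜ (φ ∨ᵢ ψ) = Σ (Team _) λ Y → Σ (Team _) λ Z →
                     IsUnion X Y Z × (Y ⊨ₜ φ) × (Z ⊨ₜ ψ)
  X ⊨ₜ ∃ᵢ φ = Σ (Assignment _ → D → Set) λ H →
                (∀ s → X s → Σ D λ m → H s m) × (supplement X H ⊨ₜ φ)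
  X ⊨ₜ ∀ᵢ φ = duplicate X ⊨ₜ φ

  REnv : List ℕ → Set₁
  REnv [] = Lift _ ⊤
  REnv (k ∷ Γ) = (Vec D k → Set) × REnv Γ

  lookupR : ∀ {Γ k} → REnv Γ → RVar Sig Γ k → Vec D k → Set
  lookupR (P , ρ) here = P
  lookupR (P , ρ) (there x) = lookupR ρ x

  -- (M, ρ) ⊨_s φ.  The greatest fixed point is the union of all
  -- post-fixed points (Knaster–Tarski).
  ⟦_⟧p : ∀ {Γ n} → PGFP Sig Γ n → REnv Γ → Assignment n → Set₁
  ⟦ lit α ⟧p ρ s = Lift _ (⟦ α ⟧l s)
  ⟦ rvar x ts ⟧p ρ s = Lift _ (lookupR ρ x (⟦ ts ⟧ts s))
  ⟦ φ ∧ₚ ψ ⟧p ρ s = ⟦ φ ⟧p ρ s × ⟦ ψ ⟧p ρ s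
  ⟦ φ ∨ₚ ψ ⟧p ρ s = ⟦ φ ⟧p ρ s ⊎ ⟦ ψ ⟧p ρ s
  ⟦ ∃ₚ φ ⟧p ρ s = Σ D λ m → ⟦ φ ⟧p ρ (m ∷ s)
  ⟦ ∀ₚ φ ⟧p ρ s = (m : D) → ⟦ φ ⟧p ρ (m ∷ s)
  ⟦ gfp k ψ ts ⟧p ρ s =
    Σ (Vec D k → Set) λ P →
      (∀ a → P a → ⟦ ψ ⟧p (P , ρ) (a ++ s)) × P (⟦ ts ⟧ts s)

  allVars : (n : ℕ) → Vec (Term Sig n) n
  allVars n = tabulate var

-- The team X is represented by the relation R = X(x̄), and φ* says of each
-- assignment what its membership in X implies: literals and conjunction
-- translate to themselves, t̄₁ ⊆ t̄₂ becomes ∃ȳ (R ȳ ∧ t̄₂(ȳ) = t̄₁(x̄)), and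
-- ∀v turns R(v, ȳ) into R(ȳ). A split X = Y ∪ Z, or a choice function H for
-- ∃v, is a subteam S of X with S ⊨ ψ, i.e. (by induction) with
-- ∀ȳ (S ȳ → R ȳ ∧ ψ*(S, ȳ)). Such S are exactly the post-fixed points of
-- the operator of [gfp_{S,ȳ} R ȳ ∧ ψ*(S, ȳ)]; the greatest one collects every
-- point that lies in some good subteam, and it is again a good subteam since
-- ψ* is positive in S. Hence φ ∨ ψ ↦ [gfp … φ*] x̄ ∨ [gfp … ψ*] x̄ and
-- ∃v ψ ↦ ∃v [gfp_{S,(v,ȳ)} R ȳ ∧ ψ*(S, v, ȳ)] (v, x̄).
module Submission where

open import Defs
open import Data.Nat using (ℕ; zero; suc; _+_)
open import Data.List using ([]; _∷_)
open import Data.Product using (Σ; Σ-syntax; _×_; _,_; proj₁; proj₂)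
open import Data.Sum using (_⊎_; inj₁; inj₂) renaming (map to ⊎-map)
open import Data.Unit using (tt)
open import Data.Fin using (Fin; zero; suc; _↑ˡ_; _↑ʳ_)
open import Data.Vec using (Vec; []; _∷_; _++_; lookup; tabulate)
open import Data.Vec.Properties
  using (lookup∘tabulate; tabulate∘lookup; tabulate-cong; lookup-++ˡ; lookup-++ʳ; ∷-injective)
open import Function using (id; _∘_)
open import Function.Bundles using (_⇔_; mk⇔; Equivalence)
open import Function.Construct.Identity using (⇔-id)
open import Level using (lift; lower)
open import Relation.Nullary using (¬_)
open import Relation.Unary using (∅; ⋃)
open import Relation.Binary.PropositionalEquality using (_≡_; refl; sym; trans; cong; cong₂; subst)

open Equivalence using (to; from)

select : ∀ {A : Set} {j k} → (Fin j → Fin k) → Vec A k → Vec A j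
select g v = tabulate (lookup v ∘ g)

select-id : ∀ {A : Set} {k} (v : Vec A k) → select id v ≡ v
select-id = tabulate∘lookup

select-↑ˡ : ∀ {A : Set} {j k m} (g : Fin j → Fin k) (b : Vec A k) (s : Vec A m) →
  select (λ i → g i ↑ˡ m) (b ++ s) ≡ select g b
select-↑ˡ g b s = tabulate-cong (λ i → lookup-++ˡ b s (g i))

select-↑ˡ-swap : ∀ {A : Set} {k m₁ m₂} (b : Vec A k) (s₁ : Vec A m₁) (s₂ : Vec A m₂) →
  select (_↑ˡ m₁) (b ++ s₁) ≡ select (_↑ˡ m₂) (b ++ s₂)
select-↑ˡ-swap b s₁ s₂ = trans (select-↑ˡ id b s₁) (sym (select-↑ˡ id b s₂))

select-↑ʳ : ∀ {A : Set} {j k m} (g : Fin j → Fin m) (b : Vec A k) (s : Vec A m) →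
  select (λ i → k ↑ʳ g i) (b ++ s) ≡ select g s
select-↑ʳ g b s = tabulate-cong (λ i → lookup-++ʳ b s (g i))

module Translation (Sig : Signature) where

  mutual
    renameT : ∀ {n m} → (Fin n → Fin m) → Term Sig n → Term Sig m
    renameT ι (var i) = var (ι i)
    renameT ι (app f ts) = app f (renameTs ι ts)

    renameTs : ∀ {n m k} → (Fin n → Fin m) → Vec (Term Sig n) k → Vec (Term Sig m) k
    renameTs ι [] = []
    renameTs ι (t ∷ ts) = renameT ι t ∷ renameTs ι ts

  renameL : ∀ {n m} → (Fin n → Fin m) → Literal Sig n → Literal Sig m
  renameL ι (eq t u) = eq (renameT ι t) (renameT ι u)
  renameL ι (neq t u) = neq (renameT ι t) (renameT ι u)
  renameL ι (rel r ts) = rel r (renameTs ι ts)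
  renameL ι (nrel r ts) = nrel r (renameTs ι ts)

  vars : ∀ {k n} → (Fin k → Fin n) → Vec (Term Sig n) k
  vars g = tabulate (var ∘ g)

  ext : ∀ {n m} → (Fin n → Fin m) → Fin (suc n) → Fin (suc m)
  ext ι zero = zero
  ext ι (suc i) = suc (ι i)

  ∃ₚⁿ : ∀ {Γ} k {m} → PGFP Sig Γ (k + m) → PGFP Sig Γ m
  ∃ₚⁿ zero φ = φ
  ∃ₚⁿ (suc k) φ = ∃ₚⁿ k (∃ₚ φ)

  ⊤ₚ : ∀ {Γ m} → PGFP Sig Γ m
  ⊤ₚ = ∀ₚ (lit (eq (var zero) (var zero)))

  _≐_ : ∀ {Γ m k} → Vec (Term Sig m) k → Vec (Term Sig m) k → PGFP Sig Γ m
  [] ≐ [] = ⊤ₚ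
  (t ∷ ts) ≐ (u ∷ us) = lit (eq t u) ∧ₚ (ts ≐ us)

  -- [gfp_{S,ȳ} R(σ ȳ) ∧ θ(S, ȳ)] z̄, where R is x and z̄ are the variables picked by ι.
  gfpSubteam : ∀ {Γ j k m} → RVar Sig Γ j → (Fin j → Fin k) →
    PGFP Sig (k ∷ Γ) (k + m) → (Fin k → Fin m) → PGFP Sig Γ m
  gfpSubteam {k = k} {m} x σ θ ι = gfp k (rvar (there x) (vars (λ i → σ i ↑ˡ m)) ∧ₚ θ) (vars ι)

  -- The current team X on n variables is the relation x read through π
  -- (a ∈ X iff x(π a)); ι places the n team variables among the m variables
  -- in scope, since gfp-bodies carry the outer variables along.
  translate : ∀ {Γ j n m} → RVar Sig Γ j → (Fin j → Fin n) → (Fin n → Fin m) →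
    IncFormula Sig n → PGFP Sig Γ m
  translate x π ι (lit α) = lit (renameL ι α)
  translate {n = n} {m} x π ι (inc k t₁ t₂) =
    ∃ₚⁿ n (rvar x (vars (λ i → π i ↑ˡ m)) ∧ₚ (renameTs (_↑ˡ m) t₂ ≐ renameTs (λ i → n ↑ʳ ι i) t₁))
  translate x π ι (φ ∧ᵢ ψ) = translate x π ι φ ∧ₚ translate x π ι ψ
  translate {m = m} x π ι (φ ∨ᵢ ψ) =
    gfpSubteam x π (translate here id (_↑ˡ m) φ) ι ∨ₚ gfpSubteam x π (translate here id (_↑ˡ m) ψ) ι
  translate {m = m} x π ι (∃ᵢ ψ) = ∃ₚ (gfpSubteam x (suc ∘ π) (translate here id (_↑ˡ suc m) ψ) (ext ι))
  translate x π ι (∀ᵢ ψ) = ∀ₚ (translate x (suc ∘ π) (ext ι) ψ)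

module Correctness {Sig : Signature} (M : Structure Sig) where
  open Translation Sig
  open Semantics M

  mutual
    ⟦renameT⟧ : ∀ {n m} (ι : Fin n → Fin m) (t : Term Sig n) (s : Assignment m) →
      ⟦ renameT ι t ⟧t s ≡ ⟦ t ⟧t (select ι s)
    ⟦renameT⟧ ι (var i) s = sym (lookup∘tabulate (lookup s ∘ ι) i)
    ⟦renameT⟧ ι (app f ts) s = cong (funs M f) (⟦renameTs⟧ ι ts s)

    ⟦renameTs⟧ : ∀ {n m k} (ι : Fin n → Fin m) (ts : Vec (Term Sig n) k) (s : Assignment m) →
      ⟦ renameTs ι ts ⟧ts s ≡ ⟦ ts ⟧ts (select ι s)
    ⟦renameTs⟧ ι [] s = refl
    ⟦renameTs⟧ ι (t ∷ ts) s = cong₂ _∷_ (⟦renameT⟧ ι t s) (⟦renameTs⟧ ι ts s)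

  ⟦renameL⟧ : ∀ {n m} (ι : Fin n → Fin m) (α : Literal Sig n) (s : Assignment m) →
    ⟦ renameL ι α ⟧l s ≡ ⟦ α ⟧l (select ι s)
  ⟦renameL⟧ ι (eq t u) s = cong₂ _≡_ (⟦renameT⟧ ι t s) (⟦renameT⟧ ι u s)
  ⟦renameL⟧ ι (neq t u) s = cong₂ (λ a b → ¬ a ≡ b) (⟦renameT⟧ ι t s) (⟦renameT⟧ ι u s)
  ⟦renameL⟧ ι (rel r ts) s = cong (rels M r) (⟦renameTs⟧ ι ts s)
  ⟦renameL⟧ ι (nrel r ts) s = cong (¬_ ∘ rels M r) (⟦renameTs⟧ ι ts s)

  ⟦vars⟧ : ∀ {k n} (g : Fin k → Fin n) (s : Assignment n) → ⟦ vars g ⟧ts s ≡ select g s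
  ⟦vars⟧ {zero} g s = refl
  ⟦vars⟧ {suc k} g s = cong (lookup s (g zero) ∷_) (⟦vars⟧ (g ∘ suc) s)

  ⟦vars-↑ˡ⟧ : ∀ {j k m} (g : Fin j → Fin k) (b : Vec D k) (s : Assignment m) →
    ⟦ vars (λ i → g i ↑ˡ m) ⟧ts (b ++ s) ≡ select g b
  ⟦vars-↑ˡ⟧ g b s = trans (⟦vars⟧ _ (b ++ s)) (select-↑ˡ g b s)

  ⟦allVars⟧ : ∀ {n} (s : Assignment n) → ⟦ allVars n ⟧ts s ≡ s
  ⟦allVars⟧ s = trans (⟦vars⟧ id s) (select-id s)

  ⟦∃ₚⁿ⟧ : ∀ {Γ} k {m} (φ : PGFP Sig Γ (k + m)) {ρ : REnv Γ} {s : Assignment m} →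
    ⟦ ∃ₚⁿ k φ ⟧p ρ s ⇔ (Σ[ b ∈ Vec D k ] ⟦ φ ⟧p ρ (b ++ s))
  ⟦∃ₚⁿ⟧ zero φ = mk⇔ ([] ,_) λ { ([] , p) → p }
  ⟦∃ₚⁿ⟧ (suc k) φ = mk⇔ shift unshift
    where
      shift : ⟦ ∃ₚⁿ (suc k) φ ⟧p _ _ → Σ[ b ∈ Vec D (suc k) ] ⟦ φ ⟧p _ (b ++ _)
      shift p with to (⟦∃ₚⁿ⟧ k (∃ₚ φ)) p
      ... | b , d , q = d ∷ b , q
      unshift : Σ[ b ∈ Vec D (suc k) ] ⟦ φ ⟧p _ (b ++ _) → ⟦ ∃ₚⁿ (suc k) φ ⟧p _ _
      unshift (d ∷ b , q) = from (⟦∃ₚⁿ⟧ k (∃ₚ φ)) (b , d , q)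

  ⟦≐⟧ : ∀ {Γ m k} (ts us : Vec (Term Sig m) k) {ρ : REnv Γ} {s : Assignment m} →
    ⟦ ts ≐ us ⟧p ρ s ⇔ (⟦ ts ⟧ts s ≡ ⟦ us ⟧ts s)
  ⟦≐⟧ [] [] = mk⇔ (λ _ → refl) (λ _ _ → lift refl)
  ⟦≐⟧ (t ∷ ts) (u ∷ us) = mk⇔
    (λ { (lift e , p) → cong₂ _∷_ e (to (⟦≐⟧ ts us) p) })
    (λ e → lift (proj₁ (∷-injective e)) , from (⟦≐⟧ ts us) (proj₂ (∷-injective e)))

  _⊆ᴱ_ : ∀ {Γ} → REnv Γ → REnv Γ → Set
  _⊆ᴱ_ {Γ} ρ ρ' = ∀ {k} (x : RVar Sig Γ k) a → lookupR ρ x a → lookupR ρ' x a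

  ⊆ᴱ-refl : ∀ {Γ} {ρ : REnv Γ} → ρ ⊆ᴱ ρ
  ⊆ᴱ-refl x a p = p

  ⊆ᴱ-∷ : ∀ {Γ k} {P Q : Vec D k → Set} {ρ ρ' : REnv Γ} →
    (∀ a → P a → Q a) → ρ ⊆ᴱ ρ' → (P , ρ) ⊆ᴱ (Q , ρ')
  ⊆ᴱ-∷ P⊆Q ρ⊆ρ' here = P⊆Q
  ⊆ᴱ-∷ P⊆Q ρ⊆ρ' (there x) = ρ⊆ρ' x

  ⟦⟧p-mono : ∀ {Γ n} (φ : PGFP Sig Γ n) {ρ ρ' : REnv Γ} → ρ ⊆ᴱ ρ' → ∀ {s} → ⟦ φ ⟧p ρ s → ⟦ φ ⟧p ρ' s
  ⟦⟧p-mono (lit α) ρ⊆ρ' p = p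
  ⟦⟧p-mono (rvar x ts) ρ⊆ρ' (lift p) = lift (ρ⊆ρ' x _ p)
  ⟦⟧p-mono (φ ∧ₚ ψ) ρ⊆ρ' (p , q) = ⟦⟧p-mono φ ρ⊆ρ' p , ⟦⟧p-mono ψ ρ⊆ρ' q
  ⟦⟧p-mono (φ ∨ₚ ψ) ρ⊆ρ' (inj₁ p) = inj₁ (⟦⟧p-mono φ ρ⊆ρ' p)
  ⟦⟧p-mono (φ ∨ₚ ψ) ρ⊆ρ' (inj₂ q) = inj₂ (⟦⟧p-mono ψ ρ⊆ρ' q)
  ⟦⟧p-mono (∃ₚ φ) ρ⊆ρ' (d , p) = d , ⟦⟧p-mono φ ρ⊆ρ' p
  ⟦⟧p-mono (∀ₚ φ) ρ⊆ρ' p d = ⟦⟧p-mono φ ρ⊆ρ' (p d)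
  ⟦⟧p-mono (gfp k ψ ts) ρ⊆ρ' (P , post , Pt) =
    P , (λ a Pa → ⟦⟧p-mono ψ (⊆ᴱ-∷ (λ _ p → p) ρ⊆ρ') (post a Pa)) , Pt

  ⟦translate-inc⟧ : ∀ {Γ j n m} {ρ : REnv Γ} {x : RVar Sig Γ j} {π : Fin j → Fin n} {ι : Fin n → Fin m}
    {k} (t₁ t₂ : Vec (Term Sig n) k) {s : Assignment m} →
    ⟦ translate x π ι (inc k t₁ t₂) ⟧p ρ s ⇔
      (Σ[ b ∈ Vec D n ] lookupR ρ x (select π b) × ⟦ t₂ ⟧ts b ≡ ⟦ t₁ ⟧ts (select ι s))
  ⟦translate-inc⟧ {Γ} {n = n} {m} {ρ} {x} {π} {ι} t₁ t₂ {s} = mk⇔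
    (λ p → let (b , lift r , e) = to (⟦∃ₚⁿ⟧ n body) p in
      b , subst (lookupR ρ x) (⟦vars-↑ˡ⟧ π b s) r , trans (sym (⟦t₂⟧ b)) (trans (to (⟦≐⟧ _ _) e) (⟦t₁⟧ b)))
    (λ { (b , r , e) → from (⟦∃ₚⁿ⟧ n body)
      (b , lift (subst (lookupR ρ x) (sym (⟦vars-↑ˡ⟧ π b s)) r) ,
       from (⟦≐⟧ _ _) (trans (⟦t₂⟧ b) (trans e (sym (⟦t₁⟧ b))))) })
    where
      body : PGFP Sig Γ (n + m)
      body = rvar x (vars (λ i → π i ↑ˡ m)) ∧ₚ (renameTs (_↑ˡ m) t₂ ≐ renameTs (λ i → n ↑ʳ ι i) t₁)
      ⟦t₂⟧ : ∀ b → ⟦ renameTs (_↑ˡ m) t₂ ⟧ts (b ++ s) ≡ ⟦ t₂ ⟧ts b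
      ⟦t₂⟧ b = trans (⟦renameTs⟧ _ t₂ _) (cong ⟦ t₂ ⟧ts (trans (select-↑ˡ id b s) (select-id b)))
      ⟦t₁⟧ : ∀ b → ⟦ renameTs (λ i → n ↑ʳ ι i) t₁ ⟧ts (b ++ s) ≡ ⟦ t₁ ⟧ts (select ι s)
      ⟦t₁⟧ b = trans (⟦renameTs⟧ _ t₁ _) (cong ⟦ t₁ ⟧ts (select-↑ʳ ι b s))

  gfpSubteam-reindex : ∀ {Γ j k m₁ m₂} {ρ : REnv Γ} (x : RVar Sig Γ j) (σ : Fin j → Fin k)
    {θ₁ : PGFP Sig (k ∷ Γ) (k + m₁)} {θ₂ : PGFP Sig (k ∷ Γ) (k + m₂)}
    {ι₁ : Fin k → Fin m₁} {ι₂ : Fin k → Fin m₂} {s₁ : Assignment m₁} {s₂ : Assignment m₂} →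
    (∀ P b → ⟦ θ₁ ⟧p (P , ρ) (b ++ s₁) → ⟦ θ₂ ⟧p (P , ρ) (b ++ s₂)) → select ι₁ s₁ ≡ select ι₂ s₂ →
    ⟦ gfpSubteam x σ θ₁ ι₁ ⟧p ρ s₁ → ⟦ gfpSubteam x σ θ₂ ι₂ ⟧p ρ s₂
  gfpSubteam-reindex {ρ = ρ} x σ {ι₁ = ι₁} {ι₂} {s₁} {s₂} θ₁⇒θ₂ h (P , post , Pt) =
    P ,
    (λ b Pb → let (lift r , q) = post b Pb in
      lift (subst (lookupR ρ x) (trans (⟦vars-↑ˡ⟧ σ b s₁) (sym (⟦vars-↑ˡ⟧ σ b s₂))) r) , θ₁⇒θ₂ P b q) ,
    subst P (trans (⟦vars⟧ ι₁ s₁) (trans h (sym (⟦vars⟧ ι₂ s₂)))) Pt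

  -- This is what makes the outer variables carried by gfp-bodies irrelevant.
  translate-reindex : ∀ {Γ j n m₁ m₂} (φ : IncFormula Sig n) {ρ : REnv Γ} {x : RVar Sig Γ j}
    {π : Fin j → Fin n} {ι₁ : Fin n → Fin m₁} {ι₂ : Fin n → Fin m₂}
    {s₁ : Assignment m₁} {s₂ : Assignment m₂} →
    select ι₁ s₁ ≡ select ι₂ s₂ → ⟦ translate x π ι₁ φ ⟧p ρ s₁ → ⟦ translate x π ι₂ φ ⟧p ρ s₂
  translate-reindex (lit α) {ι₁ = ι₁} {ι₂} {s₁} {s₂} h (lift p) =
    lift (subst id (trans (⟦renameL⟧ ι₁ α s₁) (trans (cong ⟦ α ⟧l h) (sym (⟦renameL⟧ ι₂ α s₂)))) p)
  translate-reindex (inc k t₁ t₂) h p =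
    let (b , r , e) = to (⟦translate-inc⟧ t₁ t₂) p in
    from (⟦translate-inc⟧ t₁ t₂) (b , r , trans e (cong ⟦ t₁ ⟧ts h))
  translate-reindex (φ ∧ᵢ ψ) h (p , q) = translate-reindex φ h p , translate-reindex ψ h q
  translate-reindex (φ ∨ᵢ ψ) {x = x} {π} {s₁ = s₁} {s₂} h (inj₁ p) =
    inj₁ (gfpSubteam-reindex x π (λ P b → translate-reindex φ (select-↑ˡ-swap b s₁ s₂)) h p)
  translate-reindex (φ ∨ᵢ ψ) {x = x} {π} {s₁ = s₁} {s₂} h (inj₂ q) =
    inj₂ (gfpSubteam-reindex x π (λ P b → translate-reindex ψ (select-↑ˡ-swap b s₁ s₂)) h q)
  translate-reindex (∃ᵢ ψ) {x = x} {π} {ι₁} {ι₂} {s₁} {s₂} h (d , p) =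
    d , gfpSubteam-reindex x (suc ∘ π) {ι₁ = ext ι₁} {ι₂ = ext ι₂}
          (λ P b → translate-reindex ψ (select-↑ˡ-swap b (d ∷ s₁) (d ∷ s₂))) (cong (d ∷_) h) p
  translate-reindex (∀ᵢ ψ) h p d = translate-reindex ψ (cong (d ∷_) h) (p d)

  translate-↑ˡ : ∀ {Γ j n m} (φ : IncFormula Sig n) {ρ : REnv Γ} {x : RVar Sig Γ j} {π : Fin j → Fin n}
    (b : Vec D n) (s : Assignment m) →
    ⟦ translate x π (_↑ˡ m) φ ⟧p ρ (b ++ s) ⇔ ⟦ translate x π id φ ⟧p ρ b
  translate-↑ˡ φ b s =
    mk⇔ (translate-reindex φ (select-↑ˡ id b s)) (translate-reindex φ (sym (select-↑ˡ id b s)))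

  Encodes : ∀ {Γ j n} → REnv Γ → RVar Sig Γ j → (Fin j → Fin n) → Team n → Set
  Encodes ρ x π X = ∀ a → X a ⇔ lookupR ρ x (select π a)

  encodes-here : ∀ {Γ n} {ρ : REnv Γ} {P T : Team n} → (∀ a → T a ⇔ P a) → Encodes (P , ρ) here id T
  encodes-here {P = P} T⇔P a = mk⇔
    (λ t → subst P (sym (select-id a)) (to (T⇔P a) t))
    (λ p → from (T⇔P a) (subst P (select-id a) p))

  module _ {Γ j k} (ρ : REnv Γ) (x : RVar Sig Γ j) (σ : Fin j → Fin k) where

    -- By translate-correct, Subteam θ P says P ⊆ {b | x(σ b)} and P ⊨ θ.
    Subteam : IncFormula Sig k → Team k → Set₁
    Subteam θ P = (∀ b → P b → lookupR ρ x (select σ b)) ×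
                  (∀ b → P b → ⟦ translate here id id θ ⟧p (P , ρ) b)

    Witness : IncFormula Sig k → Vec D k → Set₁
    Witness θ t = Σ[ P ∈ Team k ] Subteam θ P × P t

    ⟦gfpSubteam⟧ : ∀ θ {m} {ι : Fin k → Fin m} {s : Assignment m} →
      ⟦ gfpSubteam x σ (translate here id (_↑ˡ m) θ) ι ⟧p ρ s ⇔ Witness θ (select ι s)
    ⟦gfpSubteam⟧ θ {m} {ι} {s} = mk⇔
      (λ { (P , post , Pt) →
        P , ((λ b Pb → subst (lookupR ρ x) (⟦vars-↑ˡ⟧ σ b s) (lower (proj₁ (post b Pb)))) ,
             (λ b Pb → to (translate-↑ˡ θ b s) (proj₂ (post b Pb)))) ,
        subst P (⟦vars⟧ ι s) Pt })
      (λ { (P , (P⊆x , P⊨θ) , Pt) →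
        P , (λ b Pb → lift (subst (lookupR ρ x) (sym (⟦vars-↑ˡ⟧ σ b s)) (P⊆x b Pb)) ,
                      from (translate-↑ˡ θ b s) (P⊨θ b Pb)) ,
        subst P (sym (⟦vars⟧ ι s)) Pt })

    Subteam-∅ : ∀ θ → Subteam θ ∅
    Subteam-∅ θ = (λ b ()) , (λ b ())

    Subteam-⋃ : ∀ θ {I : Set} (P : I → Team k) → (∀ i → Subteam θ (P i)) → Subteam θ (⋃ I P)
    Subteam-⋃ θ P sub =
      (λ { b (i , p) → proj₁ (sub i) b p }) ,
      (λ { b (i , p) →
        ⟦⟧p-mono (translate here id id θ) (⊆ᴱ-∷ (λ a q → i , q) ⊆ᴱ-refl) (proj₂ (sub i) b p) })

    ⋃-witnesses : ∀ θ {I : Set} {t : I → Vec D k} → (∀ i → Witness θ (t i)) →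
      Σ[ Y ∈ Team k ] Subteam θ Y × (∀ i → Y (t i))
    ⋃-witnesses θ w =
      ⋃ _ (proj₁ ∘ w) , Subteam-⋃ θ _ (proj₁ ∘ proj₂ ∘ w) , λ i → i , proj₂ (proj₂ (w i))

    ⋃-witnesses-⊎ : ∀ φ ψ {I : Set} {t : I → Vec D k} →
      (∀ i → Witness φ (t i) ⊎ Witness ψ (t i)) →
      Σ[ Y ∈ Team k ] Σ[ Z ∈ Team k ] Subteam φ Y × Subteam ψ Z × (∀ i → Y (t i) ⊎ Z (t i))
    ⋃-witnesses-⊎ φ ψ {I} {t} w =
      ⋃ I left , ⋃ I right , Subteam-⋃ φ left left-sub , Subteam-⋃ ψ right right-sub ,
      λ i → ⊎-map (i ,_) (i ,_) (point i)
      where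
        left right : I → Team k
        left i with w i
        ... | inj₁ (P , _) = P
        ... | inj₂ _ = ∅
        right i with w i
        ... | inj₁ _ = ∅
        ... | inj₂ (Q , _) = Q
        left-sub : ∀ i → Subteam φ (left i)
        left-sub i with w i
        ... | inj₁ (_ , sub , _) = sub
        ... | inj₂ _ = Subteam-∅ φ
        right-sub : ∀ i → Subteam ψ (right i)
        right-sub i with w i
        ... | inj₁ _ = Subteam-∅ ψ
        ... | inj₂ (_ , sub , _) = sub
        point : ∀ i → left i (t i) ⊎ right i (t i)
        point i with w i
        ... | inj₁ (_ , _ , Pt) = inj₁ Pt
        ... | inj₂ (_ , _ , Qt) = inj₂ Qt

  mutual
    translate-correct : ∀ {Γ j n} (φ : IncFormula Sig n) {ρ : REnv Γ} {x : RVar Sig Γ j}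
      {π : Fin j → Fin n} {X : Team n} →
      Encodes ρ x π X → X ⊨ₜ φ ⇔ (∀ a → X a → ⟦ translate x π id φ ⟧p ρ a)
    translate-correct (lit α) enc = mk⇔
      (λ { (lift h) a xa → lift (subst id (sym (⟦renameL-id⟧ a)) (h a xa)) })
      (λ H → lift λ a xa → subst id (⟦renameL-id⟧ a) (lower (H a xa)))
      where
        ⟦renameL-id⟧ : ∀ a → ⟦ renameL id α ⟧l a ≡ ⟦ α ⟧l a
        ⟦renameL-id⟧ a = trans (⟦renameL⟧ id α a) (cong ⟦ α ⟧l (select-id a))
    translate-correct (inc k t₁ t₂) enc = mk⇔
      (λ { (lift h) a xa → let (b , xb , e) = h (⟦ t₁ ⟧ts a) (a , xa , refl) in
          from (⟦translate-inc⟧ t₁ t₂) (b , to (enc b) xb , trans e (cong ⟦ t₁ ⟧ts (sym (select-id a)))) })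
      (λ H → lift λ { c (a , xa , refl) → let (b , r , e) = to (⟦translate-inc⟧ t₁ t₂) (H a xa) in
          b , from (enc b) r , trans e (cong ⟦ t₁ ⟧ts (select-id a)) })
    translate-correct (φ ∧ᵢ ψ) enc = mk⇔
      (λ { (hφ , hψ) a xa → to (translate-correct φ enc) hφ a xa , to (translate-correct ψ enc) hψ a xa })
      (λ H → from (translate-correct φ enc) (λ a xa → proj₁ (H a xa)) ,
             from (translate-correct ψ enc) (λ a xa → proj₂ (H a xa)))
    translate-correct (φ ∨ᵢ ψ) {ρ = ρ} {x} {π} {X} enc = mk⇔ split join
      where
        witness-of : ∀ θ {Y : Team _} → (∀ b → Y b → X b) → Y ⊨ₜ θ →
          ∀ {a} → Y a → Witness ρ x π θ (select id a)
        witness-of θ {Y} Y⊆X Y⊨θ {a} ya =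
          Y , ((λ b yb → to (enc b) (Y⊆X b yb)) , to (⊨⇔pointwise θ) Y⊨θ) , subst Y (sym (select-id a)) ya

        split : X ⊨ₜ (φ ∨ᵢ ψ) → ∀ a → X a → ⟦ translate x π id (φ ∨ᵢ ψ) ⟧p ρ a
        split (Y , Z , (cover , Y⊆X , Z⊆X) , Y⊨φ , Z⊨ψ) a xa with cover a xa
        ... | inj₁ ya = inj₁ (from (⟦gfpSubteam⟧ ρ x π φ) (witness-of φ Y⊆X Y⊨φ ya))
        ... | inj₂ za = inj₂ (from (⟦gfpSubteam⟧ ρ x π ψ) (witness-of ψ Z⊆X Z⊨ψ za))

        join : (∀ a → X a → ⟦ translate x π id (φ ∨ᵢ ψ) ⟧p ρ a) → X ⊨ₜ (φ ∨ᵢ ψ)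
        join H with ⋃-witnesses-⊎ ρ x π φ ψ {Σ _ X} {select id ∘ proj₁} (λ { (a , xa) →
                      ⊎-map (to (⟦gfpSubteam⟧ ρ x π φ)) (to (⟦gfpSubteam⟧ ρ x π ψ)) (H a xa) })
        ... | Y , Z , Y-sub , Z-sub , cover =
          Y , Z ,
          ((λ a xa → ⊎-map (subst Y (select-id a)) (subst Z (select-id a)) (cover (a , xa))) ,
           (λ b yb → from (enc b) (proj₁ Y-sub b yb)) ,
           (λ b zb → from (enc b) (proj₁ Z-sub b zb))) ,
          from (⊨⇔pointwise φ) (proj₂ Y-sub) , from (⊨⇔pointwise ψ) (proj₂ Z-sub)
    translate-correct (∃ᵢ ψ) {ρ = ρ} {x} {π} {X} enc = mk⇔ choose collect
      where
        choose : X ⊨ₜ ∃ᵢ ψ → ∀ a → X a → ⟦ translate x π id (∃ᵢ ψ) ⟧p ρ a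
        choose (H , H-nonempty , T⊨ψ) a xa =
          let (d , hd) = H-nonempty a xa in
          d , from (⟦gfpSubteam⟧ ρ x (suc ∘ π) ψ {ι = ext id})
                (supplement X H , ((λ { (_ ∷ b) (xb , _) → to (enc b) xb }) , to (⊨⇔pointwise ψ) T⊨ψ) ,
                 subst (supplement X H) (cong (d ∷_) (sym (select-id a))) (xa , hd))

        collect : (∀ a → X a → ⟦ translate x π id (∃ᵢ ψ) ⟧p ρ a) → X ⊨ₜ ∃ᵢ ψ
        collect F with ⋃-witnesses ρ x (suc ∘ π) ψ {Σ _ X} {λ { (a , xa) → proj₁ (F a xa) ∷ select id a }}
                         (λ { (a , xa) → to (⟦gfpSubteam⟧ ρ x (suc ∘ π) ψ {ι = ext id}) (proj₂ (F a xa)) })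
        ... | Y , Y-sub , Y∋ =
          H , H-nonempty ,
          from (translate-correct ψ (encodes-here {ρ = ρ} T⇔Y)) (λ b tb → proj₂ Y-sub b (to (T⇔Y b) tb))
          where
            H : Assignment _ → D → Set
            H a d = Y (d ∷ a)
            H-nonempty : ∀ a → X a → Σ D (H a)
            H-nonempty a xa = proj₁ (F a xa) , subst Y (cong (_ ∷_) (select-id a)) (Y∋ (a , xa))
            T⇔Y : ∀ b → supplement X H b ⇔ Y b
            T⇔Y (d ∷ a) = mk⇔ proj₂ (λ y → from (enc a) (proj₁ Y-sub (d ∷ a) y) , y)
    translate-correct (∀ᵢ ψ) {ρ = ρ} {x} {π} {X} enc = mk⇔
      (λ h a xa d → translate-reindex ψ {ι₁ = id} {ext id} refl (to IH h (d ∷ a) xa))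
      (λ H → from IH λ { (d ∷ a) xa → translate-reindex ψ {ι₁ = ext id} {id} refl (H a xa d) })
      where
        IH : duplicate X ⊨ₜ ψ ⇔ (∀ b → duplicate X b → ⟦ translate x (suc ∘ π) id ψ ⟧p ρ b)
        IH = translate-correct ψ {x = x} {suc ∘ π} {duplicate X} λ { (d ∷ a) → enc a }

    ⊨⇔pointwise : ∀ {Γ n} (φ : IncFormula Sig n) {ρ : REnv Γ} {Y : Team n} →
      Y ⊨ₜ φ ⇔ (∀ a → Y a → ⟦ translate here id id φ ⟧p (Y , ρ) a)
    ⊨⇔pointwise φ {ρ} = translate-correct φ (encodes-here {ρ = ρ} (λ _ → ⇔-id _))

  encodes-valuesOf : ∀ {n} (X : Team n) → Encodes (valuesOf X (allVars n) , lift tt) here id X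
  encodes-valuesOf X a = mk⇔
    (λ xa → a , xa , trans (⟦allVars⟧ a) (sym (select-id a)))
    (λ { (s , xs , e) → subst X (trans (sym (⟦allVars⟧ s)) (trans e (select-id a))) xs })

theorem15 : (Sig : Signature) (n : ℕ) (φ : IncFormula Sig n) →
    Σ (PGFP Sig (n ∷ []) n) λ φ* →
    (M : Structure Sig) (X : Semantics.Team M n) →
    Semantics._⊨ₜ_ M X φ ⇔
    (∀ s → X s →
    Semantics.⟦_⟧p M φ* (Semantics.valuesOf M X (Semantics.allVars M n) , lift tt) s)
theorem15 Sig n φ =
  Translation.translate Sig here id id φ ,
  λ M X → Correctness.translate-correct M φ (Correctness.encodes-valuesOf M X)
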